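{- Let $K$ be a field with a valuation $v$ (with values in $\mathbb{Z}\cup\{\infty\}$). Let $f(Y)=a_0+a_1Y+\cdots+a_dY^d\in K[Y]$. Fix $n\in\mathbb{Z}$ and let $y_0,y_1,\dots,y_d\in K$ be such that (1) $v(y_0)=v(y_1)=\cdots=v(y_d)=n$, and (2) $v(y_k-y_l)=n$ for all $k\neq l$. Then $$v(a_j)\ge \min_{0\le k\le d} v(f(y_k))-nj\quad\text{for all } j=0,1,\dots,d.$$ -}

module Defs where

open import Level using (Level; _⊔_) renaming (suc to lsuc)
open import Data.Nat as ℕ using (ℕ)
open import Data.Integer as ℤ using (ℤ)
open import Data.Fin using (Fin; zero; suc; toℕ)
open import Data.Product using (Σ; _×_)
open import Relation.Nullary using (¬_)
open import Relation.Binary.PropositionalEquality using (_≡_)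
open import Function.Bundles using (_⇔_)
open import Algebra.Bundles using (CommutativeRing)

data ℤ∞ : Set where
  fin : ℤ → ℤ∞
  ∞   : ℤ∞

infix 4 _≤∞_
data _≤∞_ : ℤ∞ → ℤ∞ → Set where
  fin≤fin : ∀ {m n} → m ℤ.≤ n → fin m ≤∞ fin n
  _≤∞∞    : ∀ x → x ≤∞ ∞

infixl 6 _+∞_
_+∞_ : ℤ∞ → ℤ∞ → ℤ∞
fin m +∞ fin n = fin (m ℤ.+ n)
fin _ +∞ ∞     = ∞
∞     +∞ _     = ∞

min∞ : ℤ∞ → ℤ∞ → ℤ∞
min∞ (fin m) (fin n) = fin (m ℤ.⊓ n)
min∞ (fin m) ∞       = fin m
min∞ ∞       y       = y

minFin : ∀ {d} → (Fin (ℕ.suc d) → ℤ∞) → ℤ∞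
minFin {ℕ.zero}  x = x zero
minFin {ℕ.suc d} x = min∞ (x zero) (minFin (λ i → x (suc i)))

record Field (c ℓ : Level) : Set (lsuc (c ⊔ ℓ)) where
  field
    commutativeRing : CommutativeRing c ℓ
  open CommutativeRing commutativeRing public
  field
    0≉1     : ¬ (0# ≈ 1#)
    inverse : ∀ x → ¬ (x ≈ 0#) → Σ Carrier (λ y → x * y ≈ 1#)

record Valuation {c ℓ} (K : Field c ℓ) : Set (c ⊔ ℓ) where
  open Field K using (Carrier; _≈_; _+_; _*_; 0#; 1#)
  field
    v      : Carrier → ℤ∞
    v-cong : ∀ {x y} → x ≈ y → v x ≡ v y
    v-∞    : ∀ x → (v x ≡ ∞) ⇔ (x ≈ 0#)
    v-mul  : ∀ x y → v (x * y) ≡ v x +∞ v y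
    v-add  : ∀ x y → min∞ (v x) (v y) ≤∞ v (x + y)

module _ {c ℓ} (K : Field c ℓ) where
  open Field K using (Carrier; _≈_; _+_; _*_; 0#; 1#)

  pow : Carrier → ℕ → Carrier
  pow x ℕ.zero    = 1#
  pow x (ℕ.suc k) = x * pow x k

  sumFin : ∀ {d} → (Fin d → Carrier) → Carrier
  sumFin {ℕ.zero}  g = 0#
  sumFin {ℕ.suc d} g = g zero + sumFin (λ i → g (suc i))

  evalPoly : ∀ {d} → (Fin (ℕ.suc d) → Carrier) → Carrier → Carrier
  evalPoly a y = sumFin (λ j → a j * pow y (toℕ j))

{-# OPTIONS --safe #-}

-- Synthetic division by Y - y₀ gives f(Y) = f(y₀) + (Y - y₀) q(Y) with deg q = d - 1. As
-- v(y_k - y₀) = n, the values of q at y₁, …, y_d have valuation ≥ M - n (M the minimum of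
-- v(f(y_k))), so by induction on d its constant term q(0) = a₁ + a₂ y₀ + … does too, and
-- a₀ = f(y₀) - y₀ q(0) has valuation ≥ M. For the higher coefficients, the polynomial
-- a₁ + a₂ Y + … = (f(Y) - a₀) / Y takes values of valuation ≥ M - n at y₁, …, y_d because
-- v(y_k) = n, and induction on d gives v(a_{j+1}) ≥ M - n - n j.

module Submission where

open import Defs
open import Data.Nat as ℕ using (ℕ)
open import Data.Integer as ℤ using (ℤ; 0ℤ; 1ℤ; +_; _≤_)
import Data.Integer.Properties as ℤₚ
open import Data.Integer.Tactic.RingSolver as ℤ-Solver using ()
open import Data.Fin using (Fin; zero; suc; toℕ)
import Data.Fin.Properties as Fin
open import Data.List using (_∷_; [])
open import Data.Maybe using (nothing)
open import Data.Empty using (⊥-elim)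
open import Function using (_∘_; Equivalence)
open import Relation.Binary.Definitions using (Reflexive; Transitive)
open import Relation.Binary.PropositionalEquality as ≡ using (_≡_; _≢_)
open import Tactic.RingSolver.Core.AlmostCommutativeRing
  using (AlmostCommutativeRing; fromCommutativeRing)
import Tactic.RingSolver.NonReflective as RingSolver
import Algebra.Properties.Ring as RingProperties
import Algebra.Properties.AbelianGroup as AbelianGroupProperties
import Algebra.Properties.CommutativeSemigroup as CommutativeSemigroupProperties
import Relation.Binary.Reasoning.Setoid as SetoidReasoning

i≤n+j⇒i-n≤j : ∀ {i j} n → i ≤ n ℤ.+ j → i ℤ.- n ≤ j
i≤n+j⇒i-n≤j {i} {j} n i≤n+j = begin
  i ℤ.- n          ≤⟨ ℤₚ.+-monoˡ-≤ (ℤ.- n) i≤n+j ⟩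
  n ℤ.+ j ℤ.- n    ≡⟨ ℤ-Solver.solve (n ∷ j ∷ []) ⟩
  j                ∎
  where open ℤₚ.≤-Reasoning

i-n≤j⇒i≤n+j : ∀ {i j} n → i ℤ.- n ≤ j → i ≤ n ℤ.+ j
i-n≤j⇒i≤n+j {i} {j} n i-n≤j = begin
  i                  ≡⟨ ℤ-Solver.solve (i ∷ n ∷ []) ⟩
  n ℤ.+ (i ℤ.- n)    ≤⟨ ℤₚ.+-monoʳ-≤ n i-n≤j ⟩
  n ℤ.+ j            ∎
  where open ℤₚ.≤-Reasoning

i+i≡0⇒i≡0 : ∀ i → i ℤ.+ i ≡ 0ℤ → i ≡ 0ℤ
i+i≡0⇒i≡0 (+ ℕ.zero) _ = ≡.refl

≤∞-refl : Reflexive _≤∞_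
≤∞-refl {fin _} = fin≤fin ℤₚ.≤-refl
≤∞-refl {∞}     = ∞ ≤∞∞

≤∞-trans : Transitive _≤∞_
≤∞-trans (fin≤fin i≤j) (fin≤fin j≤k) = fin≤fin (ℤₚ.≤-trans i≤j j≤k)
≤∞-trans {x} _ (_ ≤∞∞)              = x ≤∞∞

min∞-≤ˡ : ∀ x y → min∞ x y ≤∞ x
min∞-≤ˡ (fin i) (fin j) = fin≤fin (ℤₚ.i⊓j≤i i j)
min∞-≤ˡ (fin _) ∞       = ≤∞-refl
min∞-≤ˡ ∞       y       = y ≤∞∞

min∞-≤ʳ : ∀ x y → min∞ x y ≤∞ y
min∞-≤ʳ (fin i) (fin j) = fin≤fin (ℤₚ.i⊓j≤j i j)
min∞-≤ʳ (fin i) ∞       = fin i ≤∞∞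
min∞-≤ʳ ∞       _       = ≤∞-refl

min∞-glb : ∀ {x y z} → z ≤∞ x → z ≤∞ y → z ≤∞ min∞ x y
min∞-glb (fin≤fin k≤i) (fin≤fin k≤j) = fin≤fin (ℤₚ.⊓-glb k≤i k≤j)
min∞-glb (fin≤fin k≤i) (_ ≤∞∞)       = fin≤fin k≤i
min∞-glb (_ ≤∞∞)       z≤y           = z≤y

minFin-≤ : ∀ {d} (x : Fin (ℕ.suc d) → ℤ∞) k → minFin x ≤∞ x k
minFin-≤ {ℕ.zero}  x zero    = ≤∞-refl
minFin-≤ {ℕ.suc d} x zero    = min∞-≤ˡ (x zero) _
minFin-≤ {ℕ.suc d} x (suc k) = ≤∞-trans (min∞-≤ʳ (x zero) _) (minFin-≤ (x ∘ suc) k)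

+∞-identityʳ : ∀ x → x +∞ fin 0ℤ ≡ x
+∞-identityʳ (fin i) = ≡.cong fin (ℤₚ.+-identityʳ i)
+∞-identityʳ ∞       = ≡.refl

+∞-assoc-fin : ∀ x i j → x +∞ fin i +∞ fin j ≡ x +∞ fin (i ℤ.+ j)
+∞-assoc-fin (fin k) i j = ≡.cong fin (ℤₚ.+-assoc k i j)
+∞-assoc-fin ∞       i j = ≡.refl

x≤n+y⇒x-n≤y : ∀ {x y} n → x ≤∞ fin n +∞ y → x +∞ fin (ℤ.- n) ≤∞ y
x≤n+y⇒x-n≤y {y = fin _} n (fin≤fin i≤n+j) = fin≤fin (i≤n+j⇒i-n≤j n i≤n+j)
x≤n+y⇒x-n≤y {y = ∞}     n _               = _ ≤∞∞

x-n≤y⇒x≤n+y : ∀ {x y} n → x +∞ fin (ℤ.- n) ≤∞ y → x ≤∞ fin n +∞ y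
x-n≤y⇒x≤n+y {fin _} {fin _} n (fin≤fin i-n≤j) = fin≤fin (i-n≤j⇒i≤n+j n i-n≤j)
x-n≤y⇒x≤n+y {fin _} {∞}     n _               = _ ≤∞∞
x-n≤y⇒x≤n+y {∞}     {∞}     n _               = ∞ ≤∞∞

fin-injective : ∀ {i j} → fin i ≡ fin j → i ≡ j
fin-injective ≡.refl = ≡.refl

x≡x+x⇒x≡0 : ∀ x → x ≢ ∞ → x ≡ x +∞ x → x ≡ fin 0ℤ
x≡x+x⇒x≡0 (fin i) _   i≡i+i = ≡.cong fin (x+x≈x⇒x≈0 i (≡.sym (fin-injective i≡i+i)))
  where open RingProperties ℤₚ.+-*-ring using (x+x≈x⇒x≈0)
x≡x+x⇒x≡0 ∞       x≢∞ _     = ⊥-elim (x≢∞ ≡.refl)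

x+x≡0⇒x≡0 : ∀ x → x +∞ x ≡ fin 0ℤ → x ≡ fin 0ℤ
x+x≡0⇒x≡0 (fin i) i+i≡0 = ≡.cong fin (i+i≡0⇒i≡0 i (fin-injective i+i≡0))

module _ {c ℓ} (K : Field c ℓ) where
  open Field K hiding (zero)
  open CommutativeSemigroupProperties *-commutativeSemigroup using (x∙yz≈y∙xz)
  open AbelianGroupProperties +-abelianGroup using (//-rightDividesˡ)
  open SetoidReasoning setoid

  private
    ring-K : AlmostCommutativeRing c ℓ
    ring-K = fromCommutativeRing commutativeRing (λ _ → nothing)

  open RingSolver ring-K using (solve; _⊜_; _⊕_; _⊗_)

  sumFin-cong : ∀ {m} {g h : Fin m → Carrier} → (∀ i → g i ≈ h i) → sumFin K g ≈ sumFin K h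
  sumFin-cong {ℕ.zero}  _   = refl
  sumFin-cong {ℕ.suc m} g≈h = +-cong (g≈h zero) (sumFin-cong (g≈h ∘ suc))

  *-distribˡ-sumFin : ∀ {m} x (g : Fin m → Carrier) → x * sumFin K g ≈ sumFin K (λ i → x * g i)
  *-distribˡ-sumFin {ℕ.zero}  x g = zeroʳ x
  *-distribˡ-sumFin {ℕ.suc m} x g = trans (distribˡ x _ _) (+-congˡ (*-distribˡ-sumFin x (g ∘ suc)))

  evalPoly-zero : ∀ (a : Fin 1 → Carrier) y → evalPoly K a y ≈ a zero
  evalPoly-zero a y = trans (+-identityʳ _) (*-identityʳ (a zero))

  evalPoly-suc : ∀ {d} (a : Fin (ℕ.suc (ℕ.suc d)) → Carrier) y →
                 evalPoly K a y ≈ a zero + y * evalPoly K (a ∘ suc) y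
  evalPoly-suc a y = +-cong (*-identityʳ (a zero)) (begin
    sumFin K (λ i → a (suc i) * (y * pow K y (toℕ i)))
      ≈⟨ sumFin-cong (λ i → x∙yz≈y∙xz (a (suc i)) y (pow K y (toℕ i))) ⟩
    sumFin K (λ i → y * (a (suc i) * pow K y (toℕ i)))
      ≈⟨ *-distribˡ-sumFin y (λ i → a (suc i) * pow K y (toℕ i)) ⟨
    y * evalPoly K (a ∘ suc) y
      ∎)

  quotient : ∀ {d} → (Fin (ℕ.suc (ℕ.suc d)) → Carrier) → Carrier → Fin (ℕ.suc d) → Carrier
  quotient a y₀ zero              = evalPoly K (a ∘ suc) y₀
  quotient {ℕ.suc d} a y₀ (suc i) = quotient (a ∘ suc) y₀ i

  -- The solver has no zero test on coefficients, so it cannot cancel y₀ - y₀: the identities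
  -- below are stated in h = y - y₀, and y is rewritten to h + y₀ around them.
  evalPoly-quotient : ∀ {d} (a : Fin (ℕ.suc (ℕ.suc d)) → Carrier) y₀ y →
                      evalPoly K a y ≈ evalPoly K a y₀ + (y - y₀) * evalPoly K (quotient a y₀) y
  evalPoly-quotient {ℕ.zero} a y₀ y = begin
    evalPoly K a y
      ≈⟨ evalPoly-suc a y ⟩
    a zero + y * g y
      ≈⟨ +-congˡ (*-cong y≈h+y₀ g-constant) ⟩
    a zero + (h + y₀) * g y₀
      ≈⟨ linear-step (a zero) y₀ h (g y₀) ⟩
    (a zero + y₀ * g y₀) + h * g y₀
      ≈⟨ +-cong (evalPoly-suc a y₀) (*-congˡ (evalPoly-zero (quotient a y₀) y)) ⟨
    evalPoly K a y₀ + h * evalPoly K (quotient a y₀) y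
      ∎
    where
    g : Carrier → Carrier
    g = evalPoly K (a ∘ suc)
    h : Carrier
    h = y - y₀
    y≈h+y₀ : y ≈ h + y₀
    y≈h+y₀ = sym (//-rightDividesˡ y₀ y)
    g-constant : g y ≈ g y₀
    g-constant = trans (evalPoly-zero (a ∘ suc) y) (sym (evalPoly-zero (a ∘ suc) y₀))
    linear-step : ∀ a₀ y₀ h g → a₀ + (h + y₀) * g ≈ (a₀ + y₀ * g) + h * g
    linear-step = solve 4 (λ a₀ y₀ h g → (a₀ ⊕ (h ⊕ y₀) ⊗ g) ⊜ ((a₀ ⊕ y₀ ⊗ g) ⊕ h ⊗ g)) refl
  evalPoly-quotient {ℕ.suc d} a y₀ y = begin
    evalPoly K a y
      ≈⟨ evalPoly-suc a y ⟩
    a zero + y * g y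
      ≈⟨ +-congˡ (*-cong y≈h+y₀ (evalPoly-quotient (a ∘ suc) y₀ y)) ⟩
    a zero + (h + y₀) * (g y₀ + h * q)
      ≈⟨ horner-step (a zero) y₀ h (g y₀) q ⟩
    (a zero + y₀ * g y₀) + h * (g y₀ + (h + y₀) * q)
      ≈⟨ +-congˡ (*-congˡ (+-congˡ (*-congʳ y≈h+y₀))) ⟨
    (a zero + y₀ * g y₀) + h * (g y₀ + y * q)
      ≈⟨ +-cong (evalPoly-suc a y₀) (*-congˡ (evalPoly-suc (quotient a y₀) y)) ⟨
    evalPoly K a y₀ + h * evalPoly K (quotient a y₀) y
      ∎
    where
    g : Carrier → Carrier
    g = evalPoly K (a ∘ suc)
    h : Carrier
    h = y - y₀
    y≈h+y₀ : y ≈ h + y₀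
    y≈h+y₀ = sym (//-rightDividesˡ y₀ y)
    q : Carrier
    q = evalPoly K (quotient (a ∘ suc) y₀) y
    horner-step : ∀ a₀ y₀ h g q →
                  a₀ + (h + y₀) * (g + h * q) ≈ (a₀ + y₀ * g) + h * (g + (h + y₀) * q)
    horner-step = solve 5 (λ a₀ y₀ h g q →
      (a₀ ⊕ (h ⊕ y₀) ⊗ (g ⊕ h ⊗ q)) ⊜ ((a₀ ⊕ y₀ ⊗ g) ⊕ h ⊗ (g ⊕ (h ⊕ y₀) ⊗ q))) refl

module _ {c ℓ} {K : Field c ℓ} (V : Valuation K) where
  open Field K hiding (zero)
  open Valuation V
  open RingProperties ring using (-1*x≈-x; -‿involutive)
  open AbelianGroupProperties +-abelianGroup using (xyx⁻¹≈y; //-rightDividesʳ)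
  open ≡.≡-Reasoning

  v-1# : v 1# ≡ fin 0ℤ
  v-1# = x≡x+x⇒x≡0 (v 1#) v1#≢∞ (≡.trans (v-cong (sym (*-identityˡ 1#))) (v-mul 1# 1#))
    where
    v1#≢∞ : v 1# ≢ ∞
    v1#≢∞ v1#≡∞ = 0≉1 (sym (Equivalence.to (v-∞ 1#) v1#≡∞))

  v-‿1# : v (- 1#) ≡ fin 0ℤ
  v-‿1# = x+x≡0⇒x≡0 (v (- 1#)) (begin
    v (- 1#) +∞ v (- 1#)  ≡⟨ v-mul (- 1#) (- 1#) ⟨
    v (- 1# * - 1#)       ≡⟨ v-cong (trans (-1*x≈-x (- 1#)) (-‿involutive 1#)) ⟩
    v 1#                  ≡⟨ v-1# ⟩
    fin 0ℤ                ∎)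

  v-neg : ∀ x → v (- x) ≡ v x
  v-neg x = begin
    v (- x)          ≡⟨ v-cong (trans (sym (-1*x≈-x x)) (*-comm (- 1#) x)) ⟩
    v (x * - 1#)     ≡⟨ v-mul x (- 1#) ⟩
    v x +∞ v (- 1#)  ≡⟨ ≡.cong (v x +∞_) v-‿1# ⟩
    v x +∞ fin 0ℤ    ≡⟨ +∞-identityʳ (v x) ⟩
    v x              ∎

  ≤v-sub : ∀ {M} x y → M ≤∞ v x → M ≤∞ v y → M ≤∞ v (x - y)
  ≤v-sub {M} x y M≤vx M≤vy =
    ≤∞-trans (min∞-glb M≤vx (≡.subst (M ≤∞_) (≡.sym (v-neg y)) M≤vy)) (v-add x (- y))

  ≤v-summandˡ : ∀ {M x y z} → x ≈ y + z → M ≤∞ v x → M ≤∞ v z → M ≤∞ v y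
  ≤v-summandˡ {M} {x} {y} {z} x≈y+z M≤vx M≤vz =
    ≡.subst (M ≤∞_) (v-cong (trans (+-congʳ x≈y+z) (//-rightDividesʳ z y))) (≤v-sub x z M≤vx M≤vz)

  ≤v-summandʳ : ∀ {M x y z} → x ≈ y + z → M ≤∞ v x → M ≤∞ v y → M ≤∞ v z
  ≤v-summandʳ {M} {x} {y} {z} x≈y+z M≤vx M≤vy =
    ≡.subst (M ≤∞_) (v-cong (trans (+-congʳ x≈y+z) (xyx⁻¹≈y y z))) (≤v-sub x y M≤vx M≤vy)

  v-*ˡ : ∀ {n x} z → v x ≡ fin n → v (x * z) ≡ fin n +∞ v z
  v-*ˡ {x = x} z vx≡n = ≡.trans (v-mul x z) (≡.cong (_+∞ v z) vx≡n)

  ≤v-*ˡ⇒≤v : ∀ {M n x z} → v x ≡ fin n → M ≤∞ v (x * z) → M +∞ fin (ℤ.- n) ≤∞ v z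
  ≤v-*ˡ⇒≤v {M} {n} {z = z} vx≡n M≤vxz =
    x≤n+y⇒x-n≤y n (≡.subst (M ≤∞_) (v-*ˡ z vx≡n) M≤vxz)

  ≤v⇒≤v-*ˡ : ∀ {M n x z} → v x ≡ fin n → M +∞ fin (ℤ.- n) ≤∞ v z → M ≤∞ v (x * z)
  ≤v⇒≤v-*ˡ {M} {n} {z = z} vx≡n M-n≤vz =
    ≡.subst (M ≤∞_) (≡.sym (v-*ˡ z vx≡n)) (x-n≤y⇒x≤n+y n M-n≤vz)

  record Separated (n : ℤ) {m} (y : Fin m → Carrier) : Set where
    field
      v-point      : ∀ k → v (y k) ≡ fin n
      v-difference : ∀ k l → k ≢ l → v (y k - y l) ≡ fin n

  Separated-tail : ∀ {n m} {y : Fin (ℕ.suc m) → Carrier} → Separated n y → Separated n (y ∘ suc)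
  Separated-tail sep = record
    { v-point      = v-point ∘ suc
    ; v-difference = λ k l k≢l → v-difference (suc k) (suc l) (k≢l ∘ Fin.suc-injective)
    }
    where open Separated sep

  ≤v-constantCoefficient : ∀ {d n M} (a : Fin (ℕ.suc d) → Carrier) {y : Fin (ℕ.suc d) → Carrier} →
                           Separated n y → (∀ k → M ≤∞ v (evalPoly K a (y k))) →
                           M ≤∞ v (a zero)
  ≤v-constantCoefficient {ℕ.zero} {M = M} a {y} _ M≤vf =
    ≡.subst (M ≤∞_) (v-cong (evalPoly-zero K a (y zero))) (M≤vf zero)
  ≤v-constantCoefficient {ℕ.suc d} {n} {M} a {y} sep M≤vf =
    ≤v-summandˡ (evalPoly-suc K a y₀) (M≤vf zero) (≤v⇒≤v-*ˡ (v-point zero) M-n≤vb₀)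
    where
    open Separated sep
    y₀ : Carrier
    y₀ = y zero
    M-n≤vb : ∀ k → M +∞ fin (ℤ.- n) ≤∞ v (evalPoly K (quotient K a y₀) (y (suc k)))
    M-n≤vb k = ≤v-*ˡ⇒≤v (v-difference (suc k) zero λ ())
      (≤v-summandʳ (evalPoly-quotient K a y₀ (y (suc k))) (M≤vf (suc k)) (M≤vf zero))
    M-n≤vb₀ : M +∞ fin (ℤ.- n) ≤∞ v (quotient K a y₀ zero)
    M-n≤vb₀ = ≤v-constantCoefficient (quotient K a y₀) (Separated-tail sep) M-n≤vb

  ≤v-coefficient : ∀ {d n M} (a : Fin (ℕ.suc d) → Carrier) {y : Fin (ℕ.suc d) → Carrier} →
                   Separated n y → (∀ k → M ≤∞ v (evalPoly K a (y k))) →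
                   ∀ j → M +∞ fin (ℤ.- (n ℤ.* + toℕ j)) ≤∞ v (a j)
  ≤v-coefficient {n = n} {M} a sep M≤vf zero =
    ≡.subst (_≤∞ v (a zero)) (≡.sym M-n*0≡M) (≤v-constantCoefficient a sep M≤vf)
    where
    M-n*0≡M : M +∞ fin (ℤ.- (n ℤ.* + 0)) ≡ M
    M-n*0≡M = ≡.trans (≡.cong (λ i → M +∞ fin (ℤ.- i)) (ℤₚ.*-zeroʳ n)) (+∞-identityʳ M)
  ≤v-coefficient {ℕ.suc d} {n} {M} a {y} sep M≤vf (suc j) =
    ≡.subst (_≤∞ v (a (suc j))) M-n-nj≡M-n[1+j]
      (≤v-coefficient (a ∘ suc) (Separated-tail sep) M-n≤vg j)
    where
    open Separated sep
    M≤va₀ : M ≤∞ v (a zero)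
    M≤va₀ = ≤v-constantCoefficient a sep M≤vf
    M-n≤vg : ∀ k → M +∞ fin (ℤ.- n) ≤∞ v (evalPoly K (a ∘ suc) (y (suc k)))
    M-n≤vg k = ≤v-*ˡ⇒≤v (v-point (suc k))
      (≤v-summandʳ (evalPoly-suc K a (y (suc k))) (M≤vf (suc k)) M≤va₀)
    M-n-nj≡M-n[1+j] : M +∞ fin (ℤ.- n) +∞ fin (ℤ.- (n ℤ.* + toℕ j))
                      ≡ M +∞ fin (ℤ.- (n ℤ.* + toℕ (suc j)))
    M-n-nj≡M-n[1+j] =
      ≡.trans (+∞-assoc-fin M _ _) (≡.cong (λ i → M +∞ fin i) (-n-nj≡-n[1+j] n (+ toℕ j)))
      where
      -n-nj≡-n[1+j] : ∀ n j → ℤ.- n ℤ.+ ℤ.- (n ℤ.* j) ≡ ℤ.- (n ℤ.* (1ℤ ℤ.+ j))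
      -n-nj≡-n[1+j] = ℤ-Solver.solve-∀

lemma3p3 : ∀ {c ℓ} (K : Field c ℓ) (V : Valuation K) (d : ℕ)
           (a : Fin (ℕ.suc d) → Field.Carrier K) (n : ℤ)
           (y : Fin (ℕ.suc d) → Field.Carrier K) →
           (∀ k → Valuation.v V (y k) ≡ fin n) →
           (∀ k l → k ≢ l → Valuation.v V (Field._-_ K (y k) (y l)) ≡ fin n) →
           ∀ j → minFin (λ k → Valuation.v V (evalPoly K a (y k))) +∞ fin (ℤ.- (n ℤ.* + toℕ j))
                 ≤∞ Valuation.v V (a j)
lemma3p3 K V d a n y v-point v-difference =
  ≤v-coefficient V a (record { v-point = v-point ; v-difference = v-difference }) (minFin-≤ _)
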